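{- Let $G$ be a bridgeless graph with $m$ edges having vertices $v_1$ and $v_2$ joined by $k\ge 4$ parallel edges. Suppose that the degree of $v_1$ is $k$, the degree of $v_2$ is $k+2$, and the graph $G'$ obtained from $G$ by removing all the edges between $v_1$ and $v_2$ and suppressing the vertex $v_2$ has a cycle cover with three cycles of total length at most $44(m-k-1)/27$. Then $G$ has a cycle cover with three cycles of total length at most $44m/27$.
   Context: Graphs may have loops and parallel edges. Suppressing a vertex $v$ of degree two means replacing the two-edge path through $v$ by a single edge (i.e., contracting one of the edges incident with $v$). A cycle is a subgraph with all degrees even (possibly empty). A cycle cover is a collection of cycles such that every edge lies in at least one of them; its (total) length is the sum of the numbers of edges of its cycles. A graph is bridgeless if it has no edge-cut of size one. -}

module Defs where

open import Data.Nat using (ℕ; zero; suc; _+_; _*_; _∸_; _≤_)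
open import Data.Nat.Divisibility using (_∣_)
open import Data.Bool using (Bool; true; false; if_then_else_; _∨_; not; _∧_)
open import Data.Fin using (Fin; _≟_)
open import Data.Product using (_×_; _,_)
open import Data.List using (List; []; _∷_; length; map; filter; allFin; lookup)
open import Data.Nat.ListAction using (sum)
open import Relation.Nullary using (¬_; yes; no; does)
open import Relation.Binary.PropositionalEquality using (_≡_)

-- A (finite multi)graph on vertex set Fin n, with loops and parallel edges
-- allowed: an edge is an (unordered, stored as ordered) pair of endpoints,
-- and the graph is the list of its edges.  Edges are the positions
-- Fin (length E) in the list.
Edge : ℕ → Set
Edge n = Fin n × Fin n

Graph : ℕ → Set
Graph n = List (Edge n)

module _ {n : ℕ} where

  _==_ : Fin n → Fin n → Bool
  a == b = does (a ≟ b)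

  -- number of ends of edge e at vertex v (a loop at v counts twice)
  ends : Fin n → Edge n → ℕ
  ends v (a , b) = (if a == v then 1 else 0) + (if b == v then 1 else 0)

  degree : Graph n → Fin n → ℕ
  degree G v = sum (map (ends v) G)

  -- does edge e join u and w (u ≠ w assumed by usage)
  joins : Fin n → Fin n → Edge n → Bool
  joins u w (a , b) = ((a == u) ∧ (b == w)) ∨ ((a == w) ∧ (b == u))

  multiplicity : Graph n → Fin n → Fin n → ℕ
  multiplicity G u w = length (filter (λ e → joins u w e Data.Bool.≟ true) G)

  -- sets of edges of G, as characteristic functions on edge positions
  EdgeSet : Graph n → Set
  EdgeSet G = Fin (length G) → Bool

  size : (G : Graph n) → EdgeSet G → ℕ
  size G C = sum (map (λ i → if C i then 1 else 0) (allFin (length G)))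

  degreeIn : (G : Graph n) → EdgeSet G → Fin n → ℕ
  degreeIn G C v = sum (map (λ i → if C i then ends v (lookup G i) else 0) (allFin (length G)))

  -- a cycle: a (possibly empty) subgraph in which every degree is even
  IsCycle : (G : Graph n) → EdgeSet G → Set
  IsCycle G C = ∀ v → 2 ∣ degreeIn G C v

  HasThreeCycleCoverOfLength : Graph n → ℕ → Set
  HasThreeCycleCoverOfLength G L =
    Data.Product.Σ (EdgeSet G) λ C₁ → Data.Product.Σ (EdgeSet G) λ C₂ → Data.Product.Σ (EdgeSet G) λ C₃ →
      IsCycle G C₁ × IsCycle G C₂ × IsCycle G C₃ ×
      (∀ i → (C₁ i ∨ C₂ i ∨ C₃ i) ≡ true) ×
      (size G C₁ + size G C₂ + size G C₃ ≡ L)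

  crosses : (Fin n → Bool) → Edge n → Bool
  crosses X (a , b) = not (does (X a Data.Bool.≟ X b))

  cutSize : Graph n → (Fin n → Bool) → ℕ
  cutSize G X = length (filter (λ e → crosses X e Data.Bool.≟ true) G)

  Bridgeless : Graph n → Set
  Bridgeless G = ∀ (X : Fin n → Bool) → ¬ (cutSize G X ≡ 1)

  removeBetween : Fin n → Fin n → Graph n → Graph n
  removeBetween u w G = filter (λ e → joins u w e Data.Bool.≟ false) G

  rename : Fin n → Fin n → Edge n → Edge n
  rename v u (a , b) = (if a == v then u else a) , (if b == v then u else b)

  -- contract the first edge of G incident with v: delete it and identify v
  -- with its other end (contracting a loop just deletes it).  Applied to a
  -- vertex of degree two this is exactly suppression of v (up to v becoming
  -- an isolated vertex, which is kept in the vertex set).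
  suppress : Fin n → Graph n → Graph n
  suppress v [] = []
  suppress v ((a , b) ∷ es) =
    if a == v then map (rename v b) es
    else if b == v then map (rename v a) es
    else (a , b) ∷ suppress v es

module Submission where

-- Let P be the k parallel edges between v₁ and v₂ and
-- R = removeBetween v₁ v₂ G the remaining edges, so G is a reordering of
-- P ++ R and v₂ has degree 2 in R.
--  * The bundle P (k ≠ 1) has a 3-cycle cover of length at most k + 1:
--    pair up its edges into 2-cycles, using one triangle-like triple of
--    labels {2}, {1,2}, {1} when k is odd.
--  * A 3-cycle cover of the suppressed graph suppress v₂ R lifts to one of R
--    that is longer by at most 3: the contracted edge v₂x is put into exactly
--    the cycles that contain the other edge at v₂ (into cycle 1 if it is a
--    loop), and a parity computation shows that all cycles stay even.
--  * Covers of P and R combine to a cover of P ++ R, hence of G, and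
--    27 (L' + k + 4) ≤ 44 m follows from 27 L' ≤ 44 (m - k - 1) as k ≥ 4.
-- Cycle covers are handled as lists of edges each carrying a label (the set
-- of cycles containing it); the file first develops parities, labelled edge
-- lists and their degrees, then relates labelled lists to the index-based
-- covers of Defs, and finally treats bundles and suppression.

open import Defs
open import Algebra.Properties.CommutativeSemigroup as CommSemigroup using ()
open import Data.Bool as Bool using (Bool; true; false; if_then_else_; _∨_)
open import Data.Bool.Properties using (if-eta)
open import Data.Empty using (⊥-elim)
open import Data.Fin using (Fin; zero; suc; _≟_)
import Data.List as List
open import Data.List using (List; []; _∷_; _++_; map; filter; length; allFin; lookup; tabulate)
open import Data.List.Properties using (∷-injective; length-++; map-++; map-∘; map-tabulate; tabulate-lookup)
open import Data.List.Relation.Binary.Permutation.Propositional using (_↭_; ↭-refl; ↭-prep; ↭-swap; ↭-trans; ↭-sym; ↭-reflexive)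
import Data.List.Relation.Binary.Permutation.Propositional.Properties as ↭
open import Data.List.Relation.Unary.All using (All; []; _∷_)
import Data.List.Relation.Unary.All as All
import Data.List.Relation.Unary.All.Properties as All
open import Data.Maybe using (just; nothing)
open import Data.Nat using (ℕ; zero; suc; _+_; _*_; _∸_; _≤_; z≤n; s≤s; parity)
open import Data.Nat.Divisibility using (_∣_; divides; ∣-refl; ∣m∣n⇒∣m+n)
open import Data.Nat.ListAction using (sum)
open import Data.Nat.ListAction.Properties using (sum-++; sum-↭)
open import Data.Nat.Properties
  using (+-comm; +-identityʳ; +-mono-≤; +-monoˡ-≤; +-monoʳ-≤; *-monoʳ-≤; *-identityʳ; ≤-refl; ≤-reflexive; ≤-trans; n≤0⇒n≡0; n≤1+n; 1+n≢0; m≤m+n; m+n∸m≡n;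
         +-cancelˡ-≡; suc-injective; +-commutativeSemigroup; module ≤-Reasoning)
open import Data.Nat.Tactic.RingSolver using (solve)
import Data.Parity.Base as ℙ
open ℙ using (Parity; 0ℙ; 1ℙ)
import Data.Parity.Properties as ℙₚ
open import Data.Product using (Σ; _×_; _,_; proj₁; proj₂; map₁)
open import Data.Sum using (_⊎_; inj₁; inj₂)
open import Function using (_∘_)
open import Level using (0ℓ)
open import Relation.Nullary using (¬_; yes; no)
open import Relation.Binary.PropositionalEquality using (_≡_; refl; sym; trans; cong; cong₂; subst; module ≡-Reasoning)
import Tactic.RingSolver as RingSolver
import Tactic.RingSolver.Core.AlmostCommutativeRing as ACR

-- The field of parities, prepared for the ring solver.  (Note that ℙ._+_
-- and ℙ._*_ have the same precedence, so parity terms are fully bracketed.)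
ℙ-ring : ACR.AlmostCommutativeRing 0ℓ 0ℓ
ℙ-ring = ACR.fromCommutativeRing ℙₚ.+-*-commutativeRing λ { 0ℙ → just refl ; 1ℙ → nothing }

χ : Bool → Parity
χ true  = 1ℙ
χ false = 0ℙ

parity-if : ∀ b m → parity (if b then m else 0) ≡ χ b ℙ.* parity m
parity-if true  m = refl
parity-if false m = refl

parity-indicator : ∀ b → parity (if b then 1 else 0) ≡ χ b
parity-indicator true  = refl
parity-indicator false = refl

even⇒parity : ∀ {m} → 2 ∣ m → parity m ≡ 0ℙ
even⇒parity (divides q refl) = trans (ℙₚ.*-homo-* q 2) (ℙₚ.*-zeroʳ (parity q))

parity⇒even : ∀ m → parity m ≡ 0ℙ → 2 ∣ m
parity⇒even zero          _ = divides 0 refl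
parity⇒even (suc zero)    ()
parity⇒even (suc (suc m)) p = ∣m∣n⇒∣m+n (∣-refl {2}) (parity⇒even m p)

char2-cancel : ∀ p q → q ≡ p ℙ.+ ((q ℙ.+ p) ℙ.* 1ℙ)
char2-cancel p q = RingSolver.solve (p List.∷ q List.∷ List.[]) ℙ-ring

sum-map-↭ : ∀ {X : Set} (h : X → ℕ) {xs ys} → xs ↭ ys → sum (map h xs) ≡ sum (map h ys)
sum-map-↭ h π = sum-↭ (↭.map⁺ h π)

sum-map-++ : ∀ {X : Set} (h : X → ℕ) xs ys → sum (map h (xs ++ ys)) ≡ sum (map h xs) + sum (map h ys)
sum-map-++ h xs ys = trans (cong sum (map-++ h xs ys)) (sum-++ (map h xs) (map h ys))

sum-map-+ : ∀ {X : Set} (f g : X → ℕ) xs → sum (map f xs) + sum (map g xs) ≡ sum (map (λ x → f x + g x) xs)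
sum-map-+ f g []       = refl
sum-map-+ f g (x ∷ xs) =
  trans (CommSemigroup.interchange +-commutativeSemigroup (f x) (sum (map f xs)) (g x) (sum (map g xs)))
        (cong (f x + g x +_) (sum-map-+ f g xs))

sum-map-const : ∀ {X : Set} {h : X → ℕ} {c} xs → All (λ x → h x ≡ c) xs → sum (map h xs) ≡ length xs * c
sum-map-const []       []         = refl
sum-map-const (x ∷ xs) (hx ∷ hxs) = cong₂ _+_ hx (sum-map-const xs hxs)

m+n≡1 : ∀ m n → m + n ≡ 1 → (m ≡ 0 × n ≡ 1) ⊎ (m ≡ 1 × n ≡ 0)
m+n≡1 zero          n       h = inj₁ (refl , h)
m+n≡1 (suc zero)    zero    _ = inj₂ (refl , refl)
m+n≡1 (suc zero)    (suc n) ()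
m+n≡1 (suc (suc m)) n       ()

partition-↭ : ∀ {X : Set} (f : X → Bool) xs → xs ↭ filter (λ x → f x Bool.≟ true) xs ++ filter (λ x → f x Bool.≟ false) xs
partition-↭ f []       = ↭-refl
partition-↭ f (x ∷ xs) with f x
... | true  = ↭-prep x (partition-↭ f xs)
... | false = ↭-trans (↭-prep x (partition-↭ f xs)) (↭-sym (↭.shift x _ _))

module _ {A Λ : Set} where

  selected : (Λ → Bool) → (A → ℕ) → A × Λ → ℕ
  selected p g (a , l) = if p l then g a else 0

  weight : (Λ → Bool) → (A → ℕ) → List (A × Λ) → ℕ
  weight p g ls = sum (map (selected p g) ls)

  weight-≤ : ∀ p g ls → weight p g ls ≤ sum (map g (map proj₁ ls))
  weight-≤ p g []             = z≤n
  weight-≤ p g ((a , l) ∷ ls) = +-mono-≤ (selected≤ (p l)) (weight-≤ p g ls)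
    where
    selected≤ : ∀ b → (if b then g a else 0) ≤ g a
    selected≤ true  = ≤-refl
    selected≤ false = z≤n

  weight-constant : ∀ p g {c} ls → All (λ a → g a ≡ c) (map proj₁ ls) → weight p g ls ≡ weight p (λ _ → 1) ls * c
  weight-constant p g []             []         = refl
  weight-constant p g ((a , l) ∷ ls) (ga ∷ gas) with p l
  ... | true  = cong₂ _+_ ga (weight-constant p g ls gas)
  ... | false = weight-constant p g ls gas

  unmap : ∀ {B : Set} (f : A → B) xs (ls′ : List (B × Λ)) → map proj₁ ls′ ≡ map f xs →
          Σ (List (A × Λ)) λ ls → map proj₁ ls ≡ xs × ls′ ≡ map (map₁ f) ls
  unmap f []       []              _  = [] , refl , refl
  unmap f (x ∷ xs) ((b , l) ∷ ls′) eq with ∷-injective eq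
  ... | refl , eq′ with unmap f xs ls′ eq′
  ...   | ls , refl , refl = ((x , l) ∷ ls) , refl , refl

  attach : (xs : List A) → (Fin (length xs) → Λ) → List (A × Λ)
  attach xs lab = tabulate (λ i → lookup xs i , lab i)

  label-at : (ls : List (A × Λ)) → Fin (length (map proj₁ ls)) → Λ
  label-at (x ∷ ls) zero    = proj₂ x
  label-at (x ∷ ls) (suc i) = label-at ls i

  items-attach : ∀ xs lab → map proj₁ (attach xs lab) ≡ xs
  items-attach xs lab = trans (map-tabulate _ proj₁) (tabulate-lookup xs)

  attach-label-at : ∀ ls → attach (map proj₁ ls) (label-at ls) ≡ ls
  attach-label-at []       = refl
  attach-label-at (x ∷ ls) = cong (x ∷_) (attach-label-at ls)

  weight-attach : ∀ xs lab p g →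
    weight p g (attach xs lab) ≡ sum (map (λ i → if p (lab i) then g (lookup xs i) else 0) (allFin (length xs)))
  weight-attach xs lab p g =
    trans (cong sum (map-tabulate (λ i → lookup xs i , lab i) (selected p g)))
          (sym (cong sum (map-tabulate (λ i → i) (λ i → if p (lab i) then g (lookup xs i) else 0))))

char2-distrib : ∀ a b K α β → ((a ℙ.+ (K ℙ.* α)) ℙ.+ (b ℙ.+ (K ℙ.* β))) ≡ ((a ℙ.+ b) ℙ.+ (K ℙ.* (α ℙ.+ β)))
char2-distrib a b K α β = RingSolver.solve (a List.∷ b List.∷ K List.∷ α List.∷ β List.∷ List.[]) ℙ-ring

char2-cons : ∀ c E K Eʷ D Dʷ →
  ((c ℙ.* (E ℙ.+ (K ℙ.* Eʷ))) ℙ.+ (D ℙ.+ (K ℙ.* Dʷ))) ≡ (((c ℙ.* E) ℙ.+ D) ℙ.+ (K ℙ.* ((c ℙ.* Eʷ) ℙ.+ Dʷ)))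
char2-cons c E K Eʷ D Dʷ = RingSolver.solve (c List.∷ E List.∷ K List.∷ Eʷ List.∷ D List.∷ Dʷ List.∷ List.[]) ℙ-ring

char2-uncontract : ∀ c D Dʷ a b →
  ((c ℙ.* (a ℙ.+ b)) ℙ.+ D) ≡ ((D ℙ.+ ((b ℙ.+ a) ℙ.* Dʷ)) ℙ.+ ((c ℙ.+ Dʷ) ℙ.* (a ℙ.+ b)))
char2-uncontract c D Dʷ a b = RingSolver.solve (c List.∷ D List.∷ Dʷ List.∷ a List.∷ b List.∷ List.[]) ℙ-ring

module _ {n : ℕ} where

  parity-ends : ∀ v (e : Edge n) → parity (ends v e) ≡ (χ (proj₁ e == v) ℙ.+ χ (proj₂ e == v))
  parity-ends v (a , b) =
    trans (ℙₚ.+-homo-+ (if a == v then 1 else 0) (if b == v then 1 else 0))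
          (cong₂ ℙ._+_ (parity-indicator (a == v)) (parity-indicator (b == v)))

  joins-ends : ∀ {u w} (e : Edge n) → joins u w e ≡ true → ∀ v → ends v e ≡ ends v (u , w)
  joins-ends {u} {w} (a , b) h v with a ≟ u | b ≟ w | a ≟ w | b ≟ u
  ... | yes refl | yes refl | _        | _        = refl
  ... | _        | _        | yes refl | yes refl = +-comm (if w == v then 1 else 0) (if u == v then 1 else 0)
  joins-ends (a , b) () v | no _  | _     | no _  | _
  joins-ends (a , b) () v | no _  | _     | yes _ | no _
  joins-ends (a , b) () v | yes _ | no _  | no _  | _
  joins-ends (a , b) () v | yes _ | no _  | yes _ | no _

  ends-second : ∀ {u w : Fin n} → ¬ u ≡ w → ends w (u , w) ≡ 1
  ends-second {u} {w} u≢w with u ≟ w | w ≟ w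
  ... | yes u≡w | _      = ⊥-elim (u≢w u≡w)
  ... | no _    | yes _  = refl
  ... | no _    | no w≢w = ⊥-elim (w≢w refl)

  χ-rename : ∀ w x v (a : Fin n) →
    χ ((if a == w then x else a) == v) ≡ (χ (a == v) ℙ.+ ((χ (x == v) ℙ.+ χ (w == v)) ℙ.* χ (a == w)))
  χ-rename w x v a with a ≟ w
  ... | yes refl = char2-cancel (χ (a == v)) (χ (x == v))
  ... | no _     = sym (trans (cong (χ (a == v) ℙ.+_) (ℙₚ.*-zeroʳ _)) (ℙₚ.+-identityʳ _))

  parity-ends-rename : ∀ w x v (e : Edge n) →
    parity (ends v (rename w x e)) ≡ (parity (ends v e) ℙ.+ ((χ (x == v) ℙ.+ χ (w == v)) ℙ.* parity (ends w e)))
  parity-ends-rename w x v (a , b) =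
    trans (parity-ends v (rename w x (a , b)))
    (trans (cong₂ ℙ._+_ (χ-rename w x v a) (χ-rename w x v b))
    (trans (char2-distrib (χ (a == v)) (χ (b == v)) (χ (x == v) ℙ.+ χ (w == v)) (χ (a == w)) (χ (b == w)))
           (sym (cong₂ (λ s t → s ℙ.+ ((χ (x == v) ℙ.+ χ (w == v)) ℙ.* t)) (parity-ends v (a , b)) (parity-ends w (a , b))))))

  suppress-first : ∀ (w b : Fin n) es → suppress w ((w , b) ∷ es) ≡ map (rename w b) es
  suppress-first w b es with w ≟ w
  ... | yes _  = refl
  ... | no w≢w = ⊥-elim (w≢w refl)

  suppress-second : ∀ {w a : Fin n} es → ¬ a ≡ w → suppress w ((a , w) ∷ es) ≡ map (rename w a) es
  suppress-second {w} {a} es a≢w with a ≟ w | w ≟ w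
  ... | yes a≡w | _      = ⊥-elim (a≢w a≡w)
  ... | no _    | yes _  = refl
  ... | no _    | no w≢w = ⊥-elim (w≢w refl)

  edge-away : ∀ {w a b : Fin n} x es → ¬ a ≡ w → ¬ b ≡ w →
    rename w x (a , b) ≡ (a , b) × suppress w ((a , b) ∷ es) ≡ (a , b) ∷ suppress w es
  edge-away {w} {a} {b} x es a≢w b≢w with a ≟ w | b ≟ w
  ... | yes a≡w | _       = ⊥-elim (a≢w a≡w)
  ... | no _    | yes b≡w = ⊥-elim (b≢w b≡w)
  ... | no _    | no _    = refl , refl

  loop-or-single-end : ∀ (w x : Fin n) d → ends w (w , x) + d ≡ 2 → x ≡ w ⊎ d ≡ 1
  loop-or-single-end w x d h with w ≟ w | x ≟ w
  ... | yes _  | yes x≡w = inj₁ x≡w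
  ... | yes _  | no _    = inj₂ (suc-injective h)
  ... | no w≢w | _       = ⊥-elim (w≢w refl)

module _ {n : ℕ} {Λ : Set} where

  degreeL : (Λ → Bool) → Fin n → List (Edge n × Λ) → ℕ
  degreeL p v = weight p (ends v)

  IsCycleL : (Λ → Bool) → List (Edge n × Λ) → Set
  IsCycleL p ls = ∀ v → parity (degreeL p v ls) ≡ 0ℙ

  renameL : Fin n → Fin n → List (Edge n × Λ) → List (Edge n × Λ)
  renameL w x = map (map₁ (rename w x))

  parity-cons : ∀ p v (y : Edge n × Λ) ls →
    parity (degreeL p v (y ∷ ls)) ≡ ((χ (p (proj₂ y)) ℙ.* parity (ends v (proj₁ y))) ℙ.+ parity (degreeL p v ls))
  parity-cons p v y ls =
    trans (ℙₚ.+-homo-+ (selected p (ends v) y) (degreeL p v ls))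
          (cong (ℙ._+ parity (degreeL p v ls)) (parity-if (p (proj₂ y)) (ends v (proj₁ y))))

  parity-degree-rename : ∀ p w x v ls →
    parity (degreeL p v (renameL w x ls))
      ≡ (parity (degreeL p v ls) ℙ.+ ((χ (x == v) ℙ.+ χ (w == v)) ℙ.* parity (degreeL p w ls)))
  parity-degree-rename p w x v []       = sym (ℙₚ.*-zeroʳ _)
  parity-degree-rename p w x v (y ∷ ls) = begin
      parity (degreeL p v (renameL w x (y ∷ ls)))
    ≡⟨ parity-cons p v (map₁ (rename w x) y) (renameL w x ls) ⟩
      ((c ℙ.* parity (ends v (rename w x e))) ℙ.+ parity (degreeL p v (renameL w x ls)))
    ≡⟨ cong₂ (λ s t → (c ℙ.* s) ℙ.+ t) (parity-ends-rename w x v e) (parity-degree-rename p w x v ls) ⟩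
      ((c ℙ.* (parity (ends v e) ℙ.+ (K ℙ.* parity (ends w e)))) ℙ.+ (parity (degreeL p v ls) ℙ.+ (K ℙ.* parity (degreeL p w ls))))
    ≡⟨ char2-cons c _ K _ _ _ ⟩
      (((c ℙ.* parity (ends v e)) ℙ.+ parity (degreeL p v ls)) ℙ.+ (K ℙ.* ((c ℙ.* parity (ends w e)) ℙ.+ parity (degreeL p w ls))))
    ≡⟨ sym (cong₂ (λ s t → s ℙ.+ (K ℙ.* t)) (parity-cons p v y ls) (parity-cons p w y ls)) ⟩
      (parity (degreeL p v (y ∷ ls)) ℙ.+ (K ℙ.* parity (degreeL p w (y ∷ ls))))
    ∎
    where
    open ≡-Reasoning
    e : Edge n
    e = proj₁ y
    c K : Parity
    c = χ (p (proj₂ y))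
    K = χ (x == v) ℙ.+ χ (w == v)

  parity-uncontract : ∀ p {w x} (e₀ : Edge n) l₀ ls → (∀ v → ends v e₀ ≡ ends v (w , x)) → ∀ v →
    parity (degreeL p v ((e₀ , l₀) ∷ ls))
      ≡ (parity (degreeL p v (renameL w x ls)) ℙ.+ ((χ (p l₀) ℙ.+ parity (degreeL p w ls)) ℙ.* (χ (w == v) ℙ.+ χ (x == v))))
  parity-uncontract p {w} {x} e₀ l₀ ls ends₀ v = begin
      parity (degreeL p v ((e₀ , l₀) ∷ ls))
    ≡⟨ parity-cons p v (e₀ , l₀) ls ⟩
      ((c ℙ.* parity (ends v e₀)) ℙ.+ D)
    ≡⟨ cong (λ s → (c ℙ.* s) ℙ.+ D) (trans (cong parity (ends₀ v)) (parity-ends v (w , x))) ⟩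
      ((c ℙ.* (a ℙ.+ b)) ℙ.+ D)
    ≡⟨ char2-uncontract c D Dʷ a b ⟩
      ((D ℙ.+ ((b ℙ.+ a) ℙ.* Dʷ)) ℙ.+ ((c ℙ.+ Dʷ) ℙ.* (a ℙ.+ b)))
    ≡⟨ cong (ℙ._+ ((c ℙ.+ Dʷ) ℙ.* (a ℙ.+ b))) (sym (parity-degree-rename p w x v ls)) ⟩
      (parity (degreeL p v (renameL w x ls)) ℙ.+ ((c ℙ.+ Dʷ) ℙ.* (a ℙ.+ b)))
    ∎
    where
    open ≡-Reasoning
    c D Dʷ a b : Parity
    c  = χ (p l₀)
    D  = parity (degreeL p v ls)
    Dʷ = parity (degreeL p w ls)
    a  = χ (w == v)
    b  = χ (x == v)

  uncontract-cycle : ∀ p {w x} (e₀ : Edge n) l₀ ls → (∀ v → ends v e₀ ≡ ends v (w , x)) →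
    χ (p l₀) ≡ parity (degreeL p w ls) ⊎ x ≡ w → IsCycleL p (renameL w x ls) → IsCycleL p ((e₀ , l₀) ∷ ls)
  uncontract-cycle p {w} {x} e₀ l₀ ls ends₀ compatible cycle v =
    trans (parity-uncontract p e₀ l₀ ls ends₀ v) (cong₂ ℙ._+_ (cycle v) (correction compatible))
    where
    correction : χ (p l₀) ≡ parity (degreeL p w ls) ⊎ x ≡ w →
      ((χ (p l₀) ℙ.+ parity (degreeL p w ls)) ℙ.* (χ (w == v) ℙ.+ χ (x == v))) ≡ 0ℙ
    correction (inj₁ same) = cong (ℙ._* _) (trans (cong (ℙ._+ _) same) (ℙₚ.p+p≡0ℙ (parity (degreeL p w ls))))
    correction (inj₂ refl) = trans (cong (_ ℙ.*_) (ℙₚ.p+p≡0ℙ (χ (w == v)))) (ℙₚ.*-zeroʳ _)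

  single-end : ∀ {Q : Λ → Set} w ls → All (Q ∘ proj₂) ls → sum (map (ends w) (map proj₁ ls)) ≡ 1 →
    Σ Λ λ l → Q l × (∀ p → degreeL p w ls ≡ (if p l then 1 else 0))
  single-end w ((e , l) ∷ ls) (ql ∷ qls) h with m+n≡1 (ends w e) _ h
  ... | inj₁ (none , one) =
    let l′ , ql′ , deg = single-end w ls qls one
    in  l′ , ql′ , λ p → cong₂ _+_ (trans (cong (λ z → if p l then z else 0) none) (if-eta (p l))) (deg p)
  ... | inj₂ (one , none) =
    l , ql , λ p → trans (cong₂ _+_ (cong (λ z → if p l then z else 0) one) (no-degree p)) (+-identityʳ _)
    where
    no-degree : ∀ p → degreeL p w ls ≡ 0
    no-degree p = n≤0⇒n≡0 (subst (degreeL p w ls ≤_) none (weight-≤ p (ends w) ls))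

-- Labels for three cycles: the set of cycles containing an edge.
Label : Set
Label = Fin 3 → Bool

label : Bool → Bool → Bool → Label
label a b c zero             = a
label a b c (suc zero)       = b
label a b c (suc (suc zero)) = c

inCycle : Fin 3 → Label → Bool
inCycle i l = l i

Covered : Label → Set
Covered l = (l zero ∨ l (suc zero) ∨ l (suc (suc zero))) ≡ true

count : Label → ℕ
count l = (if l zero then 1 else 0) + (if l (suc zero) then 1 else 0) + (if l (suc (suc zero)) then 1 else 0)

count≤3 : ∀ l → count l ≤ 3
count≤3 l = +-mono-≤ (+-mono-≤ (indicator≤1 (l zero)) (indicator≤1 (l (suc zero)))) (indicator≤1 (l (suc (suc zero))))
  where
  indicator≤1 : ∀ b → (if b then 1 else 0) ≤ 1
  indicator≤1 true  = ≤-refl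
  indicator≤1 false = z≤n

total : {A : Set} → List (A × Label) → ℕ
total ls = sum (map (count ∘ proj₂) ls)

total-sizes : ∀ {A : Set} (ls : List (A × Label)) → total ls ≡
  (weight (inCycle zero) (λ _ → 1) ls + weight (inCycle (suc zero)) (λ _ → 1) ls) + weight (inCycle (suc (suc zero))) (λ _ → 1) ls
total-sizes ls = sym (trans (cong (_+ weight (inCycle (suc (suc zero))) (λ _ → 1) ls) (sum-map-+ _ _ ls)) (sum-map-+ _ _ ls))

total-map₁ : ∀ {A B : Set} (f : A → B) (ls : List (A × Label)) → total (map (map₁ f) ls) ≡ total ls
total-map₁ f ls = sym (cong sum (map-∘ {g = count ∘ proj₂} {f = map₁ f} ls))

module _ {n : ℕ} where

  record IsCoverL (ls : List (Edge n × Label)) : Set where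
    field
      cycles  : ∀ i → IsCycleL (inCycle i) ls
      covered : All (Covered ∘ proj₂) ls
  open IsCoverL public

  cycle⇒cycleL : ∀ (G : Graph n) (lab : Fin (length G) → Label) p → IsCycle G (λ i → p (lab i)) → IsCycleL p (attach G lab)
  cycle⇒cycleL G lab p even v = even⇒parity (subst (2 ∣_) (sym (weight-attach G lab p (ends v))) (even v))

  cycleL⇒cycle : ∀ (G : Graph n) (lab : Fin (length G) → Label) p → IsCycleL p (attach G lab) → IsCycle G (λ i → p (lab i))
  cycleL⇒cycle G lab p cycle v = subst (2 ∣_) (weight-attach G lab p (ends v)) (parity⇒even _ (cycle v))

  total-attach : ∀ (G : Graph n) (lab : Fin (length G) → Label) → total (attach G lab) ≡
    size G (λ i → lab i zero) + size G (λ i → lab i (suc zero)) + size G (λ i → lab i (suc (suc zero)))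
  total-attach G lab =
    trans (total-sizes (attach G lab)) (cong₂ _+_ (cong₂ _+_ (size-at zero) (size-at (suc zero))) (size-at (suc (suc zero))))
    where
    size-at : ∀ i → weight (inCycle i) (λ _ → 1) (attach G lab) ≡ size G (λ j → lab j i)
    size-at i = weight-attach G lab (inCycle i) (λ _ → 1)

  cover⇒labelled : ∀ {G L} → HasThreeCycleCoverOfLength G L →
    Σ (List (Edge n × Label)) λ ls → map proj₁ ls ≡ G × IsCoverL ls × total ls ≡ L
  cover⇒labelled {G} (C₁ , C₂ , C₃ , even₁ , even₂ , even₃ , cov , len) =
    attach G lab , items-attach G lab , record { cycles = cyc ; covered = All.tabulate⁺ cov } , trans (total-attach G lab) len
    where
    lab : Fin (length G) → Label
    lab i = label (C₁ i) (C₂ i) (C₃ i)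
    cyc : ∀ i → IsCycleL (inCycle i) (attach G lab)
    cyc zero             = cycle⇒cycleL G lab (inCycle zero) even₁
    cyc (suc zero)       = cycle⇒cycleL G lab (inCycle (suc zero)) even₂
    cyc (suc (suc zero)) = cycle⇒cycleL G lab (inCycle (suc (suc zero))) even₃

  attached⇒cover : ∀ (G : Graph n) (lab : Fin (length G) → Label) → IsCoverL (attach G lab) → HasThreeCycleCoverOfLength G (total (attach G lab))
  attached⇒cover G lab c =
    (λ i → lab i zero) , (λ i → lab i (suc zero)) , (λ i → lab i (suc (suc zero))) ,
    cycleL⇒cycle G lab (inCycle zero) (cycles c zero) ,
    cycleL⇒cycle G lab (inCycle (suc zero)) (cycles c (suc zero)) ,
    cycleL⇒cycle G lab (inCycle (suc (suc zero))) (cycles c (suc (suc zero))) ,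
    All.tabulate⁻ (covered c) ,
    sym (total-attach G lab)

  from-labelled : ∀ {G L} ls → map proj₁ ls ≡ G → total ls ≡ L → IsCoverL ls → HasThreeCycleCoverOfLength G L
  from-labelled ls refl refl c =
    subst (HasThreeCycleCoverOfLength (map proj₁ ls)) (cong total eq)
          (attached⇒cover (map proj₁ ls) (label-at ls) (subst IsCoverL (sym eq) c))
    where
    eq : attach (map proj₁ ls) (label-at ls) ≡ ls
    eq = attach-label-at ls

  cover-resp-↭ : ∀ {ls ls′} → ls ↭ ls′ → IsCoverL ls → IsCoverL ls′
  cover-resp-↭ π c = record
    { cycles  = λ i v → trans (cong parity (sym (sum-map-↭ (selected (inCycle i) (ends v)) π))) (cycles c i v)
    ; covered = ↭.All-resp-↭ π (covered c)
    }

  cover-++ : ∀ {ls₁ ls₂} → IsCoverL ls₁ → IsCoverL ls₂ → IsCoverL (ls₁ ++ ls₂)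
  cover-++ {ls₁} {ls₂} c₁ c₂ = record
    { cycles  = λ i v → trans (cong parity (sum-map-++ (selected (inCycle i) (ends v)) ls₁ ls₂))
                        (trans (ℙₚ.+-homo-+ (degreeL (inCycle i) v ls₁) (degreeL (inCycle i) v ls₂)) (cong₂ ℙ._+_ (cycles c₁ i v) (cycles c₂ i v)))
    ; covered = All.++⁺ (covered c₁) (covered c₂)
    }

  cover-↭ : ∀ {G H L} → G ↭ H → HasThreeCycleCoverOfLength G L → HasThreeCycleCoverOfLength H L
  cover-↭ {G} {H} {L} G↭H cov with cover⇒labelled {G} {L} cov
  ... | ls , refl , c , refl with ↭.↭-map-inv proj₁ G↭H
  ...   | ls′ , refl , π = from-labelled ls′ refl (sym (sum-map-↭ (count ∘ proj₂) π)) (cover-resp-↭ π c)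

  cover-concat : ∀ {G H L M} → HasThreeCycleCoverOfLength G L → HasThreeCycleCoverOfLength H M →
    HasThreeCycleCoverOfLength (G ++ H) (L + M)
  cover-concat {G} {H} {L} {M} cov₁ cov₂ with cover⇒labelled {G} {L} cov₁ | cover⇒labelled {H} {M} cov₂
  ... | ls₁ , refl , c₁ , refl | ls₂ , refl , c₂ , refl =
    from-labelled (ls₁ ++ ls₂) (map-++ proj₁ ls₁ ls₂) (sum-map-++ (count ∘ proj₂) ls₁ ls₂) (cover-++ c₁ c₂)

record EvenClasses {A : Set} (xs : List A) : Set where
  field
    labelled    : List (A × Label)
    items       : map proj₁ labelled ≡ xs
    even-sizes : ∀ i → parity (weight (inCycle i) (λ _ → 1) labelled) ≡ 0ℙ
    all-covered  : All (Covered ∘ proj₂) labelled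
    short       : total labelled ≤ length xs + 1

even-classes : ∀ {A : Set} (xs : List A) → ¬ length xs ≡ 1 → EvenClasses xs
even-classes []               _   = record
  { labelled = [] ; items = refl ; even-sizes = λ _ → refl ; all-covered = [] ; short = z≤n }
even-classes (a ∷ [])         k≢1 = ⊥-elim (k≢1 refl)
even-classes (a ∷ b ∷ [])     _   = record
  { labelled    = (a , label true false false) ∷ (b , label true false false) ∷ []
  ; items       = refl
  ; even-sizes = λ { zero → refl ; (suc zero) → refl ; (suc (suc zero)) → refl }
  ; all-covered  = refl ∷ refl ∷ []
  ; short       = n≤1+n 2
  }
even-classes (a ∷ b ∷ c ∷ []) _   = record
  { labelled    = (a , label false true false) ∷ (b , label true true false) ∷ (c , label true false false) ∷ []
  ; items       = refl
  ; even-sizes = λ { zero → refl ; (suc zero) → refl ; (suc (suc zero)) → refl }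
  ; all-covered  = refl ∷ refl ∷ refl ∷ []
  ; short       = ≤-refl
  }
even-classes (a ∷ b ∷ rest@(_ ∷ _ ∷ _)) _ with even-classes rest (λ ())
... | classes = record
  { labelled    = (a , label true false false) ∷ (b , label true false false) ∷ labelled
  ; items       = cong (λ ys → a ∷ b ∷ ys) items
  ; even-sizes = λ { zero → even-sizes zero ; (suc zero) → even-sizes (suc zero) ; (suc (suc zero)) → even-sizes (suc (suc zero)) }
  ; all-covered  = refl ∷ refl ∷ all-covered
  ; short       = s≤s (s≤s short)
  }
  where
  open EvenClasses classes

-- A bundle of k ≠ 1 parallel edges (all with the ends of e₀) has a 3-cycle
-- cover of length at most k + 1: a class of even size has even degree
-- everywhere, since each of its edges contributes the same ends.
bundle-cover : ∀ {n} (P : Graph n) (e₀ : Edge n) → All (λ e → ∀ v → ends v e ≡ ends v e₀) P → ¬ length P ≡ 1 →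
  Σ ℕ λ L → HasThreeCycleCoverOfLength P L × L ≤ length P + 1
bundle-cover P e₀ parallel k≢1 = total labelled , from-labelled labelled items refl cover , short
  where
  open EvenClasses (even-classes P k≢1)
  cover : IsCoverL labelled
  cover = record
    { cycles  = λ i v → trans (cong parity (weight-constant (inCycle i) (ends v) labelled (same-ends v)))
                              (trans (ℙₚ.*-homo-* (weight (inCycle i) (λ _ → 1) labelled) (ends v e₀)) (cong (ℙ._* _) (even-sizes i)))
    ; covered = all-covered
    }
    where
    same-ends : ∀ v → All (λ e → ends v e ≡ ends v e₀) (map proj₁ labelled)
    same-ends v = subst (All _) (sym items) (All.map (λ same → same v) parallel)

module _ {n : ℕ} where

  between : Fin n → Fin n → Graph n → Graph n
  between u w G = filter (λ e → joins u w e Bool.≟ true) G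

  split-between : ∀ u w (G : Graph n) → G ↭ between u w G ++ removeBetween u w G
  split-between u w = partition-↭ (joins u w)

  between-parallel : ∀ u w (G : Graph n) → All (λ e → ∀ v → ends v e ≡ ends v (u , w)) (between u w G)
  between-parallel u w G = All.map (λ {e} → joins-ends e) (All.all-filter (λ e → joins u w e Bool.≟ true) G)

  degree-between : ∀ {u w : Fin n} G → ¬ u ≡ w → degree (between u w G) w ≡ multiplicity G u w
  degree-between {u} {w} G u≢w =
    trans (sum-map-const (between u w G) (All.map (λ same → trans (same w) (ends-second u≢w)) (between-parallel u w G)))
          (*-identityʳ (multiplicity G u w))

  degree-split : ∀ {G : Graph n} H K → G ↭ H ++ K → ∀ v → degree G v ≡ degree H v + degree K v
  degree-split H K π v = trans (sum-map-↭ (ends v) π) (sum-map-++ (ends v) H K)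

  length-split : ∀ {G : Graph n} H K → G ↭ H ++ K → length G ≡ length H + length K
  length-split H K π = trans (↭.↭-length π) (length-++ H)

  nonempty : ∀ (R : Graph n) w → ¬ degree R w ≡ 0 → 1 ≤ length R
  nonempty []      w isolated = ⊥-elim (isolated refl)
  nonempty (_ ∷ _) w _        = s≤s z≤n

record Contraction {n} (w : Fin n) (R : Graph n) : Set where
  field
    edge       : Edge n
    other      : Fin n
    rest       : Graph n
    edge-ends  : ∀ v → ends v edge ≡ ends v (w , other)
    split      : R ↭ edge ∷ rest
    contracted : suppress w R ↭ map (rename w other) rest

contraction : ∀ {n} (w : Fin n) R → ¬ degree R w ≡ 0 → Contraction w R
contraction w []             isolated    = ⊥-elim (isolated refl)
contraction w ((a , b) ∷ es) nonisolated with a ≟ w | b ≟ w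
... | yes refl | _        = record
  { edge = (a , b) ; other = b ; rest = es ; edge-ends = λ _ → refl ; split = ↭-refl
  ; contracted = ↭-reflexive (suppress-first _ b es) }
... | no a≢w   | yes refl = record
  { edge = (a , b) ; other = a ; rest = es ; edge-ends = λ v → +-comm (if a == v then 1 else 0) (if b == v then 1 else 0)
  ; split = ↭-refl ; contracted = ↭-reflexive (suppress-second es a≢w) }
... | no a≢w   | no b≢w   = record
  { edge       = edge
  ; other      = other
  ; rest       = (a , b) ∷ rest
  ; edge-ends  = edge-ends
  ; split      = ↭-trans (↭-prep (a , b) split) (↭-swap (a , b) edge ↭-refl)
  ; contracted = ↭-trans (↭-reflexive skipped)
                         (↭-trans (↭-prep (a , b) contracted) (↭-reflexive (cong (_∷ _) (sym fixed))))
  }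
  where
  -- (the degree of w in es is that in (a , b) ∷ es, so nonisolated applies)
  open Contraction (contraction w es nonisolated)
  fixed : rename w other (a , b) ≡ (a , b)
  fixed = proj₁ (edge-away other es a≢w b≢w)
  skipped : suppress w ((a , b) ∷ es) ≡ (a , b) ∷ suppress w es
  skipped = proj₂ (edge-away other es a≢w b≢w)

-- A cover of the contracted labelled graph lifts to the uncontracted one: the
-- edge e₀ = wx is put into the cycles of the other edge at w, or into cycle
-- 1 if it is a loop.
uncontract-cover : ∀ {n} {w x : Fin n} {e₀} ls → (∀ v → ends v e₀ ≡ ends v (w , x)) →
  x ≡ w ⊎ sum (map (ends w) (map proj₁ ls)) ≡ 1 → IsCoverL (renameL w x ls) → Σ Label λ l₀ → IsCoverL ((e₀ , l₀) ∷ ls)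
uncontract-cover {e₀ = e₀} ls ends₀ (inj₁ refl) c = label true false false , record
  { cycles  = λ i → uncontract-cycle (inCycle i) e₀ (label true false false) ls ends₀ (inj₂ refl) (cycles c i)
  ; covered = refl ∷ All.map⁻ (covered c)
  }
uncontract-cover {w = w} {e₀ = e₀} ls ends₀ (inj₂ one-end) c =
  let l , covered-l , degrees = single-end w ls (All.map⁻ (covered c)) one-end
      joins-cycles-of-l : ∀ i → χ (l i) ≡ parity (degreeL (inCycle i) w ls)
      joins-cycles-of-l i = sym (trans (cong parity (degrees (inCycle i))) (parity-indicator (l i)))
  in  l , record
    { cycles  = λ i → uncontract-cycle (inCycle i) e₀ l ls ends₀ (inj₁ (joins-cycles-of-l i)) (cycles c i)
    ; covered = covered-l ∷ All.map⁻ (covered c)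
    }

lift-contraction : ∀ {n} {w : Fin n} {R L} → degree R w ≡ 2 → Contraction w R →
  HasThreeCycleCoverOfLength (suppress w R) L → Σ ℕ λ L′ → HasThreeCycleCoverOfLength R L′ × L′ ≤ L + 3
lift-contraction {w = w} {R} {L} deg₂ record { edge = e₀ ; other = x ; rest = es ; edge-ends = ends₀ ; split = split ; contracted = contracted } cov
  with cover⇒labelled {L = L} (cover-↭ contracted cov)
... | ls′ , items′ , c′ , refl with unmap (rename w x) es ls′ items′
...   | ls , refl , refl with uncontract-cover ls ends₀ (loop-or-single-end w x _ ends-at-w) c′
  where
  ends-at-w : ends w (w , x) + sum (map (ends w) (map proj₁ ls)) ≡ 2
  ends-at-w = trans (cong (_+ sum (map (ends w) (map proj₁ ls))) (sym (ends₀ w))) (trans (sym (sum-map-↭ (ends w) split)) deg₂)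
...     | l₀ , cover = count l₀ + total ls , cover-↭ (↭-sym split) (from-labelled ((e₀ , l₀) ∷ ls) refl refl cover) , bound
  where
  bound : count l₀ + total ls ≤ total (renameL w x ls) + 3
  bound = subst (λ t → count l₀ + total ls ≤ t + 3) (sym (total-map₁ (rename w x) ls))
                (≤-trans (+-monoˡ-≤ (total ls) (count≤3 l₀)) (≤-reflexive (+-comm 3 (total ls))))

lift-suppression : ∀ {n} (w : Fin n) R {L} → degree R w ≡ 2 → HasThreeCycleCoverOfLength (suppress w R) L →
  Σ ℕ λ L′ → HasThreeCycleCoverOfLength R L′ × L′ ≤ L + 3
lift-suppression w R deg₂ = lift-contraction deg₂ (contraction w R λ isolated → 1+n≢0 (trans (sym deg₂) isolated))

final-bound : ∀ {k r L′ L} → 4 ≤ k → 1 ≤ r → 27 * L′ ≤ 44 * (r ∸ 1) → L ≤ (k + 1) + (L′ + 3) → 27 * L ≤ 44 * (k + r)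
final-bound {k} {suc r} {L′} {L} 4≤k _ bound′ bound = begin
    27 * L                     ≤⟨ *-monoʳ-≤ 27 bound ⟩
    27 * ((k + 1) + (L′ + 3))  ≡⟨ solve (k List.∷ L′ List.∷ List.[]) ⟩
    27 * L′ + (27 * k + 108)   ≤⟨ +-mono-≤ bound′ slack ⟩
    44 * r + (44 * k + 44)     ≡⟨ solve (k List.∷ r List.∷ List.[]) ⟩
    44 * (k + suc r)           ∎
  where
  open ≤-Reasoning
  slack : 27 * k + 108 ≤ 44 * k + 44
  slack = begin
    27 * k + 108        ≡⟨ solve (k List.∷ List.[]) ⟩
    27 * k + 64 + 44    ≤⟨ +-monoˡ-≤ 44 (+-monoʳ-≤ (27 * k) (≤-trans (m≤m+n 64 4) (*-monoʳ-≤ 17 4≤k))) ⟩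
    27 * k + 17 * k + 44 ≡⟨ solve (k List.∷ List.[]) ⟩
    44 * k + 44         ∎

lemma19 : (n : ℕ) (G : Graph n) (v₁ v₂ : Fin n) (k : ℕ) →
    Bridgeless G →
    4 ≤ k →
    ¬ (v₁ ≡ v₂) →
    multiplicity G v₁ v₂ ≡ k →
    degree G v₁ ≡ k →
    degree G v₂ ≡ k + 2 →
    Σ ℕ (λ L → HasThreeCycleCoverOfLength (suppress v₂ (removeBetween v₁ v₂ G)) L × 27 * L ≤ 44 * (length G ∸ k ∸ 1)) →
    Σ ℕ (λ L → HasThreeCycleCoverOfLength G L × 27 * L ≤ 44 * length G)
lemma19 n G v₁ v₂ k _ 4≤k v₁≢v₂ multiplicity≡k _ deg₂ (L′ , cover′ , bound′) =
  let LP , coverP , LP≤ = bundle-cover P (v₁ , v₂) (between-parallel v₁ v₂ G) k≢1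
      LR , coverR , LR≤ = lift-suppression v₂ R {L′} degR cover′
  in  LP + LR ,
      cover-↭ {G = P ++ R} {H = G} (↭-sym split) (cover-concat {G = P} {H = R} coverP coverR) ,
      subst (λ m → 27 * (LP + LR) ≤ 44 * m) (sym lengthG)
            (final-bound 4≤k (nonempty R v₂ (λ isolated → 1+n≢0 (trans (sym degR) isolated))) boundR
                         (+-mono-≤ (subst (λ m → LP ≤ m + 1) multiplicity≡k LP≤) LR≤))
  where
  P R : Graph n
  P = between v₁ v₂ G
  R = removeBetween v₁ v₂ G

  split : G ↭ P ++ R
  split = split-between v₁ v₂ G

  k≢1 : ¬ length P ≡ 1
  k≢1 k≡1 with subst (4 ≤_) (trans (sym multiplicity≡k) k≡1) 4≤k
  ... | s≤s ()

  -- v₂ meets P k times, so it has degree 2 in R.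
  degR : degree R v₂ ≡ 2
  degR = +-cancelˡ-≡ k _ _ (trans (cong (_+ degree R v₂) (sym (trans (degree-between G v₁≢v₂) multiplicity≡k)))
                                  (trans (sym (degree-split P R split v₂)) deg₂))

  lengthG : length G ≡ k + length R
  lengthG = trans (length-split P R split) (cong (_+ length R) multiplicity≡k)

  boundR : 27 * L′ ≤ 44 * (length R ∸ 1)
  boundR = subst (λ m → 27 * L′ ≤ 44 * m) (trans (cong (λ m → m ∸ k ∸ 1) lengthG) (cong (_∸ 1) (m+n∸m≡n k (length R)))) bound′
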